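{- For every integer $n\geq 1$, the Fibonacci-sum graph $G_n$ is outerplanar.
   Context: The Fibonacci numbers are defined by $F_0=0$, $F_1=1$ and $F_m=F_{m-1}+F_{m-2}$ for $m\geq 2$. For each integer $n\geq 1$, the Fibonacci-sum graph $G_n$ is the simple graph with vertex set $\{1,2,\dots,n\}$ in which distinct vertices $i,j$ are adjacent if and only if $i+j$ is a Fibonacci number. -}

module Defs where

open import Data.Nat using (ℕ; zero; suc; _+_; _<_)
open import Data.Nat.Properties using (+-comm)
open import Data.Fin using (Fin; toℕ)
open import Data.Fin.Permutation using (Permutation′; _⟨$⟩ʳ_)
open import Data.Product using (∃; _×_; _,_)
open import Relation.Binary.PropositionalEquality using (_≡_; _≢_; refl; sym; trans)
open import Relation.Nullary using (¬_)

fib : ℕ → ℕ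
fib zero = 0
fib (suc zero) = 1
fib (suc (suc m)) = fib (suc m) + fib m

IsFibonacci : ℕ → Set
IsFibonacci k = ∃ λ m → fib m ≡ k

record SimpleGraph (V : ℕ) : Set₁ where
  field
    Adj   : Fin V → Fin V → Set
    Adj-sym   : ∀ {i j} → Adj i j → Adj j i
    Adj-irrefl : ∀ {i} → ¬ Adj i i
open SimpleGraph public

-- Outerplanarity: the vertices can be placed on a circle (in the cyclic order
-- given by the positions σ v) so that the edges, drawn as chords, pairwise do
-- not cross. Two chords {a,b}, {c,d} cross iff their endpoints interleave,
-- i.e. (up to renaming the endpoints) σ a < σ c < σ b < σ d.  Since Adj is
-- symmetric, quantifying over all ordered pairs covers all orientations.
Outerplanar : ∀ {V} → SimpleGraph V → Set
Outerplanar {V} G =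
  ∃ λ (σ : Permutation′ V) →
    ∀ a b c d → Adj G a b → Adj G c d →
      ¬ ((toℕ (σ ⟨$⟩ʳ a) < toℕ (σ ⟨$⟩ʳ c)) ×
         (toℕ (σ ⟨$⟩ʳ c) < toℕ (σ ⟨$⟩ʳ b)) ×
         (toℕ (σ ⟨$⟩ʳ b) < toℕ (σ ⟨$⟩ʳ d)))

-- The Fibonacci-sum graph G_n: vertex  x : Fin n  stands for the integer
-- toℕ x + 1, so the vertex set is {1,…,n}; distinct vertices i, j are
-- adjacent iff i + j is a Fibonacci number.
FibAdj : (n : ℕ) → Fin n → Fin n → Set
FibAdj n x y = (x ≢ y) × IsFibonacci (suc (toℕ x) + suc (toℕ y))

fibSumGraph : (n : ℕ) → SimpleGraph n
fibSumGraph n = record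
  { Adj        = FibAdj n
  ; Adj-sym    = λ { {x} {y} (x≢y , (m , eq)) →
                     (λ e → x≢y (sym e)) ,
                     (m , trans eq (+-comm (suc (toℕ x)) (suc (toℕ y)))) }
  ; Adj-irrefl = λ { (x≢x , _) → x≢x refl }
  }

{-# OPTIONS --safe #-}
module Submission where

-- Let A < B < C = B + A < D = C + B be consecutive Fibonacci numbers. Put the vertices 1, …, B − 1
-- on a line so that no two Fibonacci-sum edges interleave and every edge of sum A, B or C joins
-- neighbours on the line. To pass to 1, …, C − 1, insert each new vertex v ∈ [B, C) immediately next
-- to its only old neighbour C − v ≤ A, on the side facing the A-neighbour of C − v, i.e. away from its
-- B-neighbour. Then edges of sum B and C still join neighbours, and so do the edges of sum D: their
-- ends C − u and C − u′ (with u + u′ = A) are attached to the facing sides of the neighbours u, u′.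
-- The new vertices only have edges of sums C and D, and an edge between neighbours crosses nothing.
-- Reading the line around a circle gives the outerplanar drawing.

open import Defs
open import Data.Bool.Properties using (T-≡)
open import Data.Empty using (⊥)
open import Data.Fin using (Fin; toℕ; fromℕ<; punchOut)
import Data.Fin.Properties as Fin
open import Data.Fin.Permutation using (Permutation′; permutation)
open import Data.Fin.Subset using (Subset; _∈_; _⊂_; ∣_∣; ⊤)
open import Data.Fin.Subset.Properties using (p⊂q⇒∣p∣<∣q∣; ∣⊤∣≡n; ∈⊤; ⊆⊤)
open import Data.Nat
  using (ℕ; zero; suc; _+_; _*_; _∸_; _≤_; _<_; _≥_; z≤n; s≤s; _≤?_; _<?_; _<ᵇ_; _≟_)
open import Data.Nat.Properties
open import Algebra.Properties.CommutativeSemigroup +-commutativeSemigroup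
  using () renaming (interchange to +-interchange)
open import Data.Product using (∃; _×_; _,_; proj₁; proj₂)
open import Data.Sum using (_⊎_; inj₁; inj₂; [_,_]′)
import Data.Sum as Sum
open import Data.Vec using (tabulate)
open import Data.Vec.Properties using (lookup∘tabulate; []=⇒lookup; lookup⇒[]=)
open import Function using (_∘_; Injective; StrictlySurjective; Equivalence)
open import Relation.Binary.Definitions using (tri<; tri≈; tri>)
open import Relation.Binary.PropositionalEquality
  using (_≡_; _≢_; refl; sym; trans; cong; cong₂; subst; subst₂; module ≡-Reasoning)
open import Relation.Nullary using (¬_; Dec; yes; no; contradiction)
open import Relation.Nullary.Decidable using (_⊎-dec_; _×-dec_)

k*a+i≤k*b+j⇒a≤b : ∀ k {a b i j} → j < k → k * a + i ≤ k * b + j → a ≤ b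
k*a+i≤k*b+j⇒a≤b k {a} {b} {i} {j} j<k le with a ≤? b
... | yes a≤b = a≤b
... | no a≰b = contradiction le (<⇒≱ (begin-strict
  k * b + j  <⟨ +-monoʳ-< (k * b) j<k ⟩
  k * b + k  ≡⟨ +-comm (k * b) k ⟩
  k + k * b  ≡⟨ *-suc k b ⟨
  k * suc b  ≤⟨ *-monoʳ-≤ k (≰⇒> a≰b) ⟩
  k * a      ≤⟨ m≤m+n (k * a) i ⟩
  k * a + i  ∎))
  where open ≤-Reasoning

k*a+i<k*b+j⇒a<b : ∀ k {a b i j} → j ≤ i → j < k → k * a + i < k * b + j → a < b
k*a+i<k*b+j⇒a<b k {a} {b} {i} {j} j≤i j<k lt
  with m≤n⇒m<n∨m≡n (k*a+i≤k*b+j⇒a≤b k j<k (<⇒≤ lt))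
... | inj₁ a<b = a<b
... | inj₂ refl = contradiction (+-cancelˡ-< (k * a) i j lt) (≤⇒≯ j≤i)

k*a+i≡k*b+j⇒a≡b : ∀ k {a b i j} → i < k → j < k → k * a + i ≡ k * b + j → a ≡ b
k*a+i≡k*b+j⇒a≡b k i<k j<k eq =
  ≤-antisym (k*a+i≤k*b+j⇒a≤b k j<k (≤-reflexive eq)) (k*a+i≤k*b+j⇒a≤b k i<k (≤-reflexive (sym eq)))

k*a+i≡k*b+j⇒i≡j : ∀ k {a b i j} → i < k → j < k → k * a + i ≡ k * b + j → i ≡ j
k*a+i≡k*b+j⇒i≡j k {a} i<k j<k eq =
  +-cancelˡ-≡ (k * a) _ _ (trans eq (cong (λ c → k * c + _) (sym (k*a+i≡k*b+j⇒a≡b k i<k j<k eq))))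

m+n≡o⇒o∸m≡n : ∀ {m n o} → m + n ≡ o → o ∸ m ≡ n
m+n≡o⇒o∸m≡n {m} {n} refl = m+n∸m≡n m n

no-room : ∀ {a w b} → b ≤ suc a → ¬ (a < w × w < b)
no-room b≤1+a (a<w , w<b) = <⇒≱ (<-≤-trans w<b b≤1+a) a<w

middle-of-three : ∀ {s b c d} → b < s → s < d → s ≡ b ⊎ s ≡ c ⊎ s ≡ d → s ≡ c
middle-of-three b<s _ (inj₁ refl) = contradiction b<s (<-irrefl refl)
middle-of-three _ _ (inj₂ (inj₁ s≡c)) = s≡c
middle-of-three _ s<d (inj₂ (inj₂ refl)) = contradiction s<d (<-irrefl refl)

lower-two-of-three : ∀ {s b c d} → s < d → s ≡ b ⊎ s ≡ c ⊎ s ≡ d → s ≡ b ⊎ s ≡ c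
lower-two-of-three _ (inj₁ s≡b) = inj₁ s≡b
lower-two-of-three _ (inj₂ (inj₁ s≡c)) = inj₂ s≡c
lower-two-of-three s<d (inj₂ (inj₂ refl)) = contradiction s<d (<-irrefl refl)

upper-of-three : ∀ {s b c d} → b < s → c < s → s ≡ b ⊎ s ≡ c ⊎ s ≡ d → s ≡ d
upper-of-three b<s _ (inj₁ refl) = contradiction b<s (<-irrefl refl)
upper-of-three _ c<s (inj₂ (inj₁ refl)) = contradiction c<s (<-irrefl refl)
upper-of-three _ _ (inj₂ (inj₂ s≡d)) = s≡d

fib-suc-pos : ∀ m → 0 < fib (suc m)
fib-suc-pos zero = s≤s z≤n
fib-suc-pos (suc zero) = s≤s z≤n
fib-suc-pos (suc (suc m)) = ≤-trans (fib-suc-pos (suc m)) (m≤m+n _ _)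

fib-≤-suc : ∀ m → fib m ≤ fib (suc m)
fib-≤-suc zero = z≤n
fib-≤-suc (suc m) = m≤m+n (fib (suc m)) (fib m)

fib-mono-≤ : ∀ {m n} → m ≤ n → fib m ≤ fib n
fib-mono-≤ {n = zero} z≤n = ≤-refl
fib-mono-≤ {m} {suc n} m≤1+n with m≤n⇒m<n∨m≡n m≤1+n
... | inj₁ m<1+n = ≤-trans (fib-mono-≤ (≤-pred m<1+n)) (fib-≤-suc n)
... | inj₂ refl = ≤-refl

fib[2+m]<fib[3+m] : ∀ m → fib (2 + m) < fib (3 + m)
fib[2+m]<fib[3+m] m =
  subst (_≤ fib (3 + m)) (+-comm (fib (2 + m)) 1) (+-monoʳ-≤ (fib (2 + m)) (fib-suc-pos m))

1+m<fib[3+m] : ∀ m → 1 + m < fib (3 + m)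
1+m<fib[3+m] zero = s≤s (s≤s z≤n)
1+m<fib[3+m] (suc m) =
  subst (_≤ fib (4 + m)) (+-comm (2 + m) 1) (+-mono-≤ (1+m<fib[3+m] m) (fib-suc-pos (suc m)))

fib-gap : ∀ m {s} → IsFibonacci s → fib m < s → s < fib (3 + m) → s ≡ fib (1 + m) ⊎ s ≡ fib (2 + m)
fib-gap m (k , refl) fib[m]<s s<fib[3+m] with k ≤? m | 3 + m ≤? k | k ≤? 1 + m
... | yes k≤m | _ | _ = contradiction (fib-mono-≤ k≤m) (<⇒≱ fib[m]<s)
... | no _ | yes 3+m≤k | _ = contradiction (fib-mono-≤ 3+m≤k) (<⇒≱ s<fib[3+m])
... | no k≰m | no _ | yes k≤1+m = inj₁ (cong fib (≤-antisym k≤1+m (≰⇒> k≰m)))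
... | no _ | no 3+m≰k | no k≰1+m = inj₂ (cong fib (≤-antisym (≤-pred (≰⇒> 3+m≰k)) (≰⇒> k≰1+m)))

-- From an injective labelling by naturals to a circular order

injective⇒strictlySurjective : ∀ {n} {h : Fin n → Fin n} → Injective _≡_ _≡_ h → StrictlySurjective _≡_ h
injective⇒strictlySurjective {suc n} {h} h-injective t with Fin.any? (λ x → h x Fin.≟ t)
... | yes hit = hit
... | no miss = contradiction (Fin.injective⇒≤ h′-injective) (<⇒≱ (n<1+n n))
  where
  t≢h : ∀ x → t ≢ h x
  t≢h x t≡hx = miss (x , sym t≡hx)
  h′ : Fin (suc n) → Fin n
  h′ x = punchOut (t≢h x)
  h′-injective : Injective _≡_ _≡_ h′
  h′-injective = h-injective ∘ Fin.punchOut-injective (t≢h _) (t≢h _)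

injective⇒permutation : ∀ {n} (h : Fin n → Fin n) → Injective _≡_ _≡_ h → Permutation′ n
injective⇒permutation h h-injective =
  permutation h (λ t → proj₁ (surjective t)) (λ t → proj₂ (surjective t))
              (λ x → h-injective (proj₂ (surjective (h x))))
  where surjective = injective⇒strictlySurjective h-injective

module Ranking {n} (f : Fin n → ℕ) where

  smaller : Fin n → Subset n
  smaller x = tabulate (λ y → f y <ᵇ f x)

  ∈smaller⇒< : ∀ {x y} → y ∈ smaller x → f y < f x
  ∈smaller⇒< {x} {y} y∈ =
    <ᵇ⇒< (f y) (f x) (Equivalence.from T-≡ (trans (sym (lookup∘tabulate _ y)) ([]=⇒lookup y∈)))

  <⇒∈smaller : ∀ {x y} → f y < f x → y ∈ smaller x
  <⇒∈smaller {x} {y} fy<fx =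
    lookup⇒[]= y _ (trans (lookup∘tabulate _ y) (Equivalence.to T-≡ (<⇒<ᵇ fy<fx)))

  ∉smaller : ∀ x → ¬ x ∈ smaller x
  ∉smaller x x∈ = <-irrefl refl (∈smaller⇒< x∈)

  smaller-⊂ : ∀ {x y} → f x < f y → smaller x ⊂ smaller y
  smaller-⊂ fx<fy =
    (λ z∈ → <⇒∈smaller (<-trans (∈smaller⇒< z∈) fx<fy)) , _ , <⇒∈smaller fx<fy , ∉smaller _

  rank : Fin n → Fin n
  rank x = fromℕ< (subst (∣ smaller x ∣ <_) (∣⊤∣≡n n) (p⊂q⇒∣p∣<∣q∣ (⊆⊤ , x , ∈⊤ , ∉smaller x)))

  rank-mono-< : ∀ {x y} → f x < f y → toℕ (rank x) < toℕ (rank y)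
  rank-mono-< fx<fy =
    subst₂ _<_ (sym (Fin.toℕ-fromℕ< _)) (sym (Fin.toℕ-fromℕ< _)) (p⊂q⇒∣p∣<∣q∣ (smaller-⊂ fx<fy))

  module _ (f-injective : Injective _≡_ _≡_ f) where

    rank-cancel-< : ∀ {x y} → toℕ (rank x) < toℕ (rank y) → f x < f y
    rank-cancel-< {x} {y} rx<ry with <-cmp (f x) (f y)
    ... | tri< fx<fy _ _ = fx<fy
    ... | tri≈ _ fx≡fy _ = contradiction rx<ry (<-irrefl (cong (toℕ ∘ rank) (f-injective fx≡fy)))
    ... | tri> _ _ fy<fx = contradiction rx<ry (<-asym (rank-mono-< fy<fx))

    rank-injective : Injective _≡_ _≡_ rank
    rank-injective {x} {y} rx≡ry with <-cmp (f x) (f y)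
    ... | tri< fx<fy _ _ = contradiction (cong toℕ rx≡ry) (<⇒≢ (rank-mono-< fx<fy))
    ... | tri≈ _ fx≡fy _ = f-injective fx≡fy
    ... | tri> _ _ fy<fx = contradiction (cong toℕ rx≡ry) (>⇒≢ (rank-mono-< fy<fx))

outerplanar-by-layout : ∀ {n} (G : SimpleGraph n) (f : Fin n → ℕ) → Injective _≡_ _≡_ f →
                        (∀ {a b c d} → Adj G a b → Adj G c d → ¬ (f a < f c × f c < f b × f b < f d)) →
                        Outerplanar G
outerplanar-by-layout G f f-injective noncrossing =
  injective⇒permutation rank (rank-injective f-injective) ,
  λ a b c d ab cd (ra<rc , rc<rb , rb<rd) →
    noncrossing ab cd (rank-cancel-< f-injective ra<rc , rank-cancel-< f-injective rc<rb ,
                       rank-cancel-< f-injective rb<rd)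
  where open Ranking f

-- Layouts of the vertices 1, …, N − 1 on a line

Vertex : ℕ → ℕ → Set
Vertex N x = 0 < x × x < N

InjectiveOn : ℕ → (ℕ → ℕ) → Set
InjectiveOn N p = ∀ {x y} → Vertex N x → Vertex N y → p x ≡ p y → x ≡ y

Consecutive : ℕ → (ℕ → ℕ) → ℕ → ℕ → Set
Consecutive N p x y = ∀ {w} → Vertex N w → ¬ (p x < p w × p w < p y)

SumConsecutive : ℕ → (ℕ → ℕ) → ℕ → Set
SumConsecutive N p s = ∀ {x y} → Vertex N x → Vertex N y → x ≢ y → x + y ≡ s → Consecutive N p x y

FibEdge : ℕ → ℕ → Set
FibEdge x y = x ≢ y × IsFibonacci (x + y)

NonCrossing : ℕ → (ℕ → ℕ) → Set
NonCrossing N p = ∀ {a b c d} → Vertex N a → Vertex N b → Vertex N c → Vertex N d →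
                  FibEdge a b → FibEdge c d → ¬ (p a < p c × p c < p b × p b < p d)

record IsLayout (A B : ℕ) (p : ℕ → ℕ) : Set where
  field
    injective      : InjectiveOn B p
    consecutive-A  : SumConsecutive B p A
    consecutive-B  : SumConsecutive B p B
    consecutive-AB : SumConsecutive B p (B + A)
    noncrossing    : NonCrossing B p

module _ {N : ℕ} {p : ℕ → ℕ} (p-injective : InjectiveOn N p) {u a b : ℕ} (va : Vertex N a) (vb : Vertex N b)
  where

  consecutive-successor-unique : Consecutive N p u a → Consecutive N p u b → p u < p a → p u < p b → a ≡ b
  consecutive-successor-unique ua ub pu<pa pu<pb with <-cmp (p a) (p b)
  ... | tri< pa<pb _ _ = contradiction (pu<pa , pa<pb) (ub va)
  ... | tri≈ _ pa≡pb _ = p-injective va vb pa≡pb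
  ... | tri> _ _ pb<pa = contradiction (pu<pb , pb<pa) (ua vb)

  consecutive-predecessor-unique : Consecutive N p a u → Consecutive N p b u → p a < p u → p b < p u → a ≡ b
  consecutive-predecessor-unique au bu pa<pu pb<pu with <-cmp (p a) (p b)
  ... | tri< pa<pb _ _ = contradiction (pa<pb , pb<pu) (au vb)
  ... | tri≈ _ pa≡pb _ = p-injective va vb pa≡pb
  ... | tri> _ _ pb<pa = contradiction (pb<pa , pa<pu) (bu va)

-- Extending a layout of 1, …, B − 1 to one of 1, …, C − 1

module Extension (A B : ℕ) (p : ℕ → ℕ) where

  C D : ℕ
  C = B + A
  D = C + B

  -- Whether the new vertex C ∸ u is placed right after u rather than right before it: away from the
  -- B-partner of u, or towards its A-partner when u is its own B-partner.
  AttachAfter : ℕ → Set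
  AttachAfter u = p (B ∸ u) < p u ⊎ (B ∸ u ≡ u × p u < p (A ∸ u))

  attachAfter? : ∀ u → Dec (AttachAfter u)
  attachAfter? u = p (B ∸ u) <? p u ⊎-dec (B ∸ u ≟ u ×-dec p u <? p (A ∸ u))

  slot : ℕ → ℕ
  slot u with attachAfter? u
  ... | yes _ = 2
  ... | no _ = 0

  slot≤2 : ∀ u → slot u ≤ 2
  slot≤2 u with attachAfter? u
  ... | yes _ = ≤-refl
  ... | no _ = z≤n

  slot≢1 : ∀ u → slot u ≢ 1
  slot≢1 u with attachAfter? u
  ... | yes _ = λ ()
  ... | no _ = λ ()

  1<slot⇒attachAfter : ∀ {u} → 1 < slot u → AttachAfter u
  1<slot⇒attachAfter {u} 1<slot with attachAfter? u
  ... | yes after = after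
  ... | no _ = contradiction 1<slot λ ()

  slot<1⇒¬attachAfter : ∀ {u} → slot u < 1 → ¬ AttachAfter u
  slot<1⇒¬attachAfter {u} slot<1 with attachAfter? u
  ... | yes _ = contradiction slot<1 λ { (s≤s ()) }
  ... | no ¬after = ¬after

  slot-attachAfter : ∀ {u} → AttachAfter u → slot u ≡ 2
  slot-attachAfter {u} after with attachAfter? u
  ... | yes _ = refl
  ... | no ¬after = contradiction after ¬after

  slot-¬attachAfter : ∀ {u} → ¬ AttachAfter u → slot u ≡ 0
  slot-¬attachAfter {u} ¬after with attachAfter? u
  ... | yes after = contradiction after ¬after
  ... | no _ = refl

  -- Position 3 * p u + 1 is the old vertex u; the new vertex attached to u takes 3 * p u or 3 * p u + 2.
  extend : ℕ → ℕ
  extend v with v <? B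
  ... | yes _ = 3 * p v + 1
  ... | no _ = 3 * p (C ∸ v) + slot (C ∸ v)

  extend-old : ∀ {v} → v < B → extend v ≡ 3 * p v + 1
  extend-old {v} v<B with v <? B
  ... | yes _ = refl
  ... | no v≮B = contradiction v<B v≮B

  extend-new : ∀ {v} → B ≤ v → extend v ≡ 3 * p (C ∸ v) + slot (C ∸ v)
  extend-new {v} B≤v with v <? B
  ... | yes v<B = contradiction v<B (≤⇒≯ B≤v)
  ... | no _ = refl

  extend-cancel-< : ∀ {x y} → x < B → y < B → extend x < extend y → p x < p y
  extend-cancel-< x<B y<B qx<qy =
    k*a+i<k*b+j⇒a<b 3 ≤-refl (s≤s (s≤s z≤n)) (subst₂ _<_ (extend-old x<B) (extend-old y<B) qx<qy)

  attached-after-consecutive : ∀ {x y} → x < B → B ≤ y → C ∸ y ≡ x → Consecutive C extend x y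
  attached-after-consecutive {x} {y} x<B B≤y C∸y≡x _ = no-room (begin
    extend y                      ≡⟨ extend-new B≤y ⟩
    3 * p (C ∸ y) + slot (C ∸ y)  ≡⟨ cong (λ t → 3 * p t + slot t) C∸y≡x ⟩
    3 * p x + slot x              ≤⟨ +-monoʳ-≤ (3 * p x) (slot≤2 x) ⟩
    3 * p x + 2                   ≡⟨ +-suc (3 * p x) 1 ⟩
    suc (3 * p x + 1)             ≡⟨ cong suc (extend-old x<B) ⟨
    suc (extend x)                ∎)
    where open ≤-Reasoning

  attached-before-consecutive : ∀ {x y} → B ≤ x → y < B → C ∸ x ≡ y → Consecutive C extend x y
  attached-before-consecutive {x} {y} B≤x y<B C∸x≡y _ = no-room (begin
    extend y                            ≡⟨ extend-old y<B ⟩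
    3 * p y + 1                         ≤⟨ +-monoʳ-≤ (3 * p y) (s≤s z≤n) ⟩
    3 * p y + suc (slot y)              ≡⟨ +-suc (3 * p y) (slot y) ⟩
    suc (3 * p y + slot y)              ≡⟨ cong (λ t → suc (3 * p t + slot t)) C∸x≡y ⟨
    suc (3 * p (C ∸ x) + slot (C ∸ x))  ≡⟨ cong suc (extend-new B≤x) ⟨
    suc (extend x)                      ∎)
    where open ≤-Reasoning

  module _ (A<B : A < B) (layout : IsLayout A B p)
           (fib-gap : ∀ {s} → IsFibonacci s → B < s → s < D + C → s ≡ C ⊎ s ≡ D) where

    open IsLayout layout

    old-vertex : ∀ {v} → Vertex C v → v < B → Vertex B v
    old-vertex (0<v , _) v<B = 0<v , v<B

    anchor-≤A : ∀ {v} → B ≤ v → C ∸ v ≤ A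
    anchor-≤A B≤v = ≤-trans (∸-monoʳ-≤ C B≤v) (≤-reflexive (m+n∸m≡n B A))

    anchor-vertex : ∀ {v} → Vertex C v → B ≤ v → Vertex B (C ∸ v)
    anchor-vertex (_ , v<C) B≤v = m<n⇒0<n∸m v<C , ≤-<-trans (anchor-≤A B≤v) A<B

    B-partner-vertex : ∀ {u} → Vertex B u → Vertex B (B ∸ u)
    B-partner-vertex (0<u , u<B) = m<n⇒0<n∸m u<B , ∸-monoʳ-< 0<u (<⇒≤ u<B)

    A-partner≢B-partner : ∀ {u t t′} → u + t ≡ A → u + t′ ≡ B → t ≢ t′
    A-partner≢B-partner u+t≡A u+t′≡B refl = <⇒≢ A<B (trans (sym u+t≡A) u+t′≡B)

    attachAfter⇒B-partner-before : ∀ {u y} → u + y ≡ B → u ≢ y → AttachAfter u → p y < p u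
    attachAfter⇒B-partner-before {u} u+y≡B _ (inj₁ pt<pu) = subst (λ t → p t < p u) (m+n≡o⇒o∸m≡n u+y≡B) pt<pu
    attachAfter⇒B-partner-before u+y≡B u≢y (inj₂ (B∸u≡u , _)) =
      contradiction (trans (sym B∸u≡u) (m+n≡o⇒o∸m≡n u+y≡B)) u≢y

    B-partner-before⇒attachAfter : ∀ {u y} → u + y ≡ B → p y < p u → AttachAfter u
    B-partner-before⇒attachAfter {u} u+y≡B py<pu =
      inj₁ (subst (λ t → p t < p u) (sym (m+n≡o⇒o∸m≡n u+y≡B)) py<pu)

    -- Both partners of u are its neighbours on the line, so they lie on opposite sides of u.
    module _ {u u′} (vu : Vertex B u) (vu′ : Vertex B u′) (u+u′≡A : u + u′ ≡ A) (u≢u′ : u ≢ u′)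
             (pu<pu′ : p u < p u′) where

      A-partner-after⇒attachAfter : AttachAfter u
      A-partner-after⇒attachAfter with B ∸ u ≟ u
      ... | yes B∸u≡u = inj₂ (B∸u≡u , subst (λ t → p u < p t) (sym (m+n≡o⇒o∸m≡n u+u′≡A)) pu<pu′)
      ... | no B∸u≢u with <-cmp (p (B ∸ u)) (p u)
      ...   | tri< pt<pu _ _ = inj₁ pt<pu
      ...   | tri≈ _ pt≡pu _ = contradiction (injective (B-partner-vertex vu) vu pt≡pu) B∸u≢u
      ...   | tri> _ _ pu<pt = contradiction
                (consecutive-successor-unique injective vu′ (B-partner-vertex vu)
                   (consecutive-A vu vu′ u≢u′ u+u′≡A)
                   (consecutive-B vu (B-partner-vertex vu) (B∸u≢u ∘ sym) u+[B∸u]≡B) pu<pu′ pu<pt)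
                (A-partner≢B-partner u+u′≡A u+[B∸u]≡B)
        where u+[B∸u]≡B = m+[n∸m]≡n (<⇒≤ (proj₂ vu))

      A-partner-before⇒¬attachAfter : ¬ AttachAfter u′
      A-partner-before⇒¬attachAfter (inj₁ pt<pu′) = A-partner≢B-partner u′+u≡A u′+[B∸u′]≡B (sym t≡u)
        where
        u′+u≡A = trans (+-comm u′ u) u+u′≡A
        u′+[B∸u′]≡B = m+[n∸m]≡n (<⇒≤ (proj₂ vu′))
        t≡u : B ∸ u′ ≡ u
        t≡u = consecutive-predecessor-unique injective (B-partner-vertex vu′) vu
                (consecutive-B (B-partner-vertex vu′) vu′ (λ t≡u′ → <-irrefl (cong p t≡u′) pt<pu′)
                               (m∸n+n≡m (<⇒≤ (proj₂ vu′))))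
                (consecutive-A vu vu′ u≢u′ u+u′≡A) pt<pu′ pu<pu′
      A-partner-before⇒¬attachAfter (inj₂ (_ , pu′<pA∸u′)) =
        <-asym pu<pu′ (subst (λ t → p u′ < p t) (m+n≡o⇒o∸m≡n (trans (+-comm u′ u) u+u′≡A)) pu′<pA∸u′)

    new-between-old : ∀ {x y w} → Vertex B x → Vertex B y → Consecutive B p x y → Vertex C w → B ≤ w →
                      3 * p x + 1 < extend w → extend w < 3 * p y + 1 →
                      (C ∸ w ≡ x × AttachAfter x) ⊎ (C ∸ w ≡ y × ¬ AttachAfter y)
    new-between-old {x} {y} {w} vx vy xy vw B≤w qx<qw qw<qy =
      cases (m≤n⇒m<n∨m≡n (k*a+i≤k*b+j⇒a≤b 3 (s≤s (slot≤2 z)) (<⇒≤ qx<qz)))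
            (m≤n⇒m<n∨m≡n (k*a+i≤k*b+j⇒a≤b 3 (s≤s (s≤s z≤n)) (<⇒≤ qz<qy)))
      where
      z = C ∸ w
      vz = anchor-vertex vw B≤w
      qx<qz : 3 * p x + 1 < 3 * p z + slot z
      qx<qz = subst (_ <_) (extend-new B≤w) qx<qw
      qz<qy : 3 * p z + slot z < 3 * p y + 1
      qz<qy = subst (_< _) (extend-new B≤w) qw<qy
      cases : p x < p z ⊎ p x ≡ p z → p z < p y ⊎ p z ≡ p y →
              (z ≡ x × AttachAfter x) ⊎ (z ≡ y × ¬ AttachAfter y)
      cases (inj₂ px≡pz) _ = inj₁ (z≡x , subst AttachAfter z≡x after-z)
        where
        z≡x = injective vz vx (sym px≡pz)
        after-z : AttachAfter z
        after-z = 1<slot⇒attachAfter (+-cancelˡ-< (3 * p z) 1 (slot z)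
                    (subst (λ t → 3 * t + 1 < 3 * p z + slot z) px≡pz qx<qz))
      cases _ (inj₂ pz≡py) = inj₂ (z≡y , subst (¬_ ∘ AttachAfter) z≡y ¬after-z)
        where
        z≡y = injective vz vy pz≡py
        ¬after-z : ¬ AttachAfter z
        ¬after-z = slot<1⇒¬attachAfter (+-cancelˡ-< (3 * p z) (slot z) 1
                     (subst (λ t → 3 * p z + slot z < 3 * t + 1) (sym pz≡py) qz<qy))
      cases (inj₁ px<pz) (inj₁ pz<py) = contradiction (px<pz , pz<py) (xy vz)

    B-or-C-sum≡B : ∀ {x y} → x ≤ A → y < B → x + y ≡ B ⊎ x + y ≡ C → x + y ≡ B
    B-or-C-sum≡B _ _ (inj₁ x+y≡B) = x+y≡B
    B-or-C-sum≡B {x} {y} x≤A y<B (inj₂ x+y≡C) =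
      contradiction x+y≡C (<⇒≢ (subst (x + y <_) (+-comm A B) (+-mono-≤-< x≤A y<B)))

    old-old-consecutive : ∀ {x y} → Vertex B x → Vertex B y → x ≢ y → x + y ≡ B ⊎ x + y ≡ C →
                          Consecutive C extend x y
    old-old-consecutive {x} {y} vx vy x≢y sum {w} vw (qx<qw , qw<qy) = [ old-w , new-w ]′ (<-≤-connex w B)
      where
      x<B = proj₂ vx
      y<B = proj₂ vy
      xy : Consecutive B p x y
      xy = [ consecutive-B vx vy x≢y , consecutive-AB vx vy x≢y ]′ sum
      px<py : p x < p y
      px<py = extend-cancel-< x<B y<B (<-trans qx<qw qw<qy)
      old-w : w < B → ⊥
      old-w w<B = xy (old-vertex vw w<B) (extend-cancel-< x<B w<B qx<qw , extend-cancel-< w<B y<B qw<qy)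
      new-w : B ≤ w → ⊥
      new-w B≤w
        with new-between-old vx vy xy vw B≤w (subst (_< _) (extend-old x<B) qx<qw)
                                             (subst (_ <_) (extend-old y<B) qw<qy)
      ... | inj₁ (z≡x , after-x) = <-asym px<py (attachAfter⇒B-partner-before x+y≡B x≢y after-x)
        where x+y≡B = B-or-C-sum≡B (subst (_≤ A) z≡x (anchor-≤A B≤w)) y<B sum
      ... | inj₂ (z≡y , ¬after-y) = ¬after-y (B-partner-before⇒attachAfter y+x≡B px<py)
        where
        y+x≡ : ∀ {s} → x + y ≡ s → y + x ≡ s
        y+x≡ = trans (+-comm y x)
        y+x≡B = B-or-C-sum≡B (subst (_≤ A) z≡y (anchor-≤A B≤w)) x<B (Sum.map y+x≡ y+x≡ sum)

    extend-anchor : ∀ {w} → Vertex C w → ∃ λ a → Vertex B a × ∃ λ i → i ≤ 2 × extend w ≡ 3 * p a + i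
    extend-anchor {w} vw with <-≤-connex w B
    ... | inj₁ w<B = w , old-vertex vw w<B , 1 , s≤s z≤n , extend-old w<B
    ... | inj₂ B≤w = C ∸ w , anchor-vertex vw B≤w , slot (C ∸ w) , slot≤2 (C ∸ w) , extend-new B≤w

    anchors-A-edge : ∀ {x y} → x < C → y < C → x + y ≡ D → (C ∸ x) + (C ∸ y) ≡ A
    anchors-A-edge {x} {y} x<C y<C x+y≡D = +-cancelʳ-≡ (x + y) _ _ (begin
      (C ∸ x) + (C ∸ y) + (x + y)  ≡⟨ +-interchange (C ∸ x) (C ∸ y) x y ⟩
      (C ∸ x + x) + (C ∸ y + y)    ≡⟨ cong₂ _+_ (m∸n+n≡m (<⇒≤ x<C)) (m∸n+n≡m (<⇒≤ y<C)) ⟩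
      C + (B + A)                  ≡⟨ +-assoc C B A ⟨
      D + A                        ≡⟨ +-comm D A ⟩
      A + D                        ≡⟨ cong (A +_) x+y≡D ⟨
      A + (x + y)                  ∎)
      where open ≡-Reasoning

    new-new-consecutive : ∀ {x y} → Vertex C x → Vertex C y → B ≤ x → B ≤ y → x ≢ y → x + y ≡ D →
                          Consecutive C extend x y
    new-new-consecutive {x} {y} vx vy B≤x B≤y x≢y x+y≡D vw (qx<qw , qw<qy)
      with a , va , i , i≤2 , qw≡ ← extend-anchor vw =
      consecutive-A vu vu′ u≢u′ u+u′≡A va
        (k*a+i<k*b+j⇒a<b 3 i≤2 (s≤s i≤2) (subst₂ _<_ qx≡ qw≡ qx<qw) ,
         k*a+i<k*b+j⇒a<b 3 z≤n (s≤s z≤n) (subst₂ _<_ qw≡ qy≡ qw<qy))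
      where
      u = C ∸ x
      u′ = C ∸ y
      vu = anchor-vertex vx B≤x
      vu′ = anchor-vertex vy B≤y
      u+u′≡A = anchors-A-edge (proj₂ vx) (proj₂ vy) x+y≡D
      u≢u′ : u ≢ u′
      u≢u′ = x≢y ∘ ∸-cancelˡ-≡ (<⇒≤ (proj₂ vx)) (<⇒≤ (proj₂ vy))
      pu<pu′ : p u < p u′
      pu<pu′ = ≤∧≢⇒< (k*a+i≤k*b+j⇒a≤b 3 (s≤s (slot≤2 u′))
                       (<⇒≤ (subst₂ _<_ (extend-new B≤x) (extend-new B≤y) (<-trans qx<qw qw<qy))))
                     (u≢u′ ∘ injective vu vu′)
      qx≡ : extend x ≡ 3 * p u + 2
      qx≡ = trans (extend-new B≤x) (cong (3 * p u +_) (slot-attachAfter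
              (A-partner-after⇒attachAfter vu vu′ u+u′≡A u≢u′ pu<pu′)))
      qy≡ : extend y ≡ 3 * p u′ + 0
      qy≡ = trans (extend-new B≤y) (cong (3 * p u′ +_) (slot-¬attachAfter
              (A-partner-before⇒¬attachAfter vu vu′ u+u′≡A u≢u′ pu<pu′)))

    extend-consecutive : ∀ {x y} → Vertex C x → Vertex C y → x ≢ y → x + y ≡ B ⊎ x + y ≡ C ⊎ x + y ≡ D →
                         Consecutive C extend x y
    extend-consecutive {x} {y} vx vy x≢y sum with <-≤-connex x B | <-≤-connex y B
    ... | inj₁ x<B | inj₁ y<B =
      old-old-consecutive (old-vertex vx x<B) (old-vertex vy y<B) x≢y (lower-two-of-three x+y<D sum)
      where x+y<D = <-≤-trans (+-mono-< x<B y<B) (+-monoˡ-≤ B (m≤m+n B A))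
    ... | inj₁ x<B | inj₂ B≤y =
      attached-after-consecutive x<B B≤y (m+n≡o⇒o∸m≡n (trans (+-comm y x) (middle-of-three B<x+y x+y<D sum)))
      where
      B<x+y = +-mono-≤ (proj₁ vx) B≤y
      x+y<D = subst (x + y <_) (+-comm B C) (+-mono-< x<B (proj₂ vy))
    ... | inj₂ B≤x | inj₁ y<B =
      attached-before-consecutive B≤x y<B (m+n≡o⇒o∸m≡n (middle-of-three B<x+y x+y<D sum))
      where
      B<x+y = subst (_≤ x + y) (+-comm B 1) (+-mono-≤ B≤x (proj₁ vy))
      x+y<D = +-mono-< (proj₂ vx) y<B
    ... | inj₂ B≤x | inj₂ B≤y =
      new-new-consecutive vx vy B≤x B≤y x≢y (upper-of-three B<x+y C<x+y sum)
      where
      B<x+y = <-≤-trans (m<m+n B (≤-<-trans z≤n A<B)) (+-mono-≤ B≤x B≤y)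
      C<x+y = <-≤-trans (+-monoʳ-< B A<B) (+-mono-≤ B≤x B≤y)

    extend-injective : InjectiveOn C extend
    extend-injective {x} {y} vx vy qx≡qy with <-≤-connex x B | <-≤-connex y B
    ... | inj₁ x<B | inj₁ y<B = injective (old-vertex vx x<B) (old-vertex vy y<B)
      (k*a+i≡k*b+j⇒a≡b 3 (s≤s (s≤s z≤n)) (s≤s (s≤s z≤n))
        (subst₂ _≡_ (extend-old x<B) (extend-old y<B) qx≡qy))
    ... | inj₁ x<B | inj₂ B≤y = contradiction
      (k*a+i≡k*b+j⇒i≡j 3 {p x} {p (C ∸ y)} (s≤s (s≤s z≤n)) (s≤s (slot≤2 _))
        (subst₂ _≡_ (extend-old x<B) (extend-new B≤y) qx≡qy))
      (slot≢1 _ ∘ sym)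
    ... | inj₂ B≤x | inj₁ y<B = contradiction
      (k*a+i≡k*b+j⇒i≡j 3 {p (C ∸ x)} {p y} (s≤s (slot≤2 _)) (s≤s (s≤s z≤n))
        (subst₂ _≡_ (extend-new B≤x) (extend-old y<B) qx≡qy))
      (slot≢1 _)
    ... | inj₂ B≤x | inj₂ B≤y = ∸-cancelˡ-≡ (<⇒≤ (proj₂ vx)) (<⇒≤ (proj₂ vy))
      (injective (anchor-vertex vx B≤x) (anchor-vertex vy B≤y)
        (k*a+i≡k*b+j⇒a≡b 3 (s≤s (slot≤2 _)) (s≤s (slot≤2 _))
          (subst₂ _≡_ (extend-new B≤x) (extend-new B≤y) qx≡qy)))

    new-edge-consecutive : ∀ {x y} → Vertex C x → Vertex C y → FibEdge x y → B ≤ x ⊎ B ≤ y →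
                           Consecutive C extend x y
    new-edge-consecutive {x} {y} vx vy (x≢y , fib-x+y) new =
      extend-consecutive vx vy x≢y (inj₂ (fib-gap fib-x+y (B<x+y new) x+y<D+C))
      where
      B<x+y : B ≤ x ⊎ B ≤ y → B < x + y
      B<x+y (inj₁ B≤x) = subst (_≤ x + y) (+-comm B 1) (+-mono-≤ B≤x (proj₁ vy))
      B<x+y (inj₂ B≤y) = +-mono-≤ (proj₁ vx) B≤y
      x+y<D+C = +-mono-< (<-≤-trans (proj₂ vx) (m≤m+n C B)) (proj₂ vy)

    extend-noncrossing : NonCrossing C extend
    extend-noncrossing {a} {b} {c} {d} va vb vc vd ab cd (qa<qc , qc<qb , qb<qd)
      with <-≤-connex a B | <-≤-connex b B | <-≤-connex c B | <-≤-connex d B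
    ... | inj₁ a<B | inj₁ b<B | inj₁ c<B | inj₁ d<B =
      noncrossing (old-vertex va a<B) (old-vertex vb b<B) (old-vertex vc c<B) (old-vertex vd d<B) ab cd
        (extend-cancel-< a<B c<B qa<qc , extend-cancel-< c<B b<B qc<qb , extend-cancel-< b<B d<B qb<qd)
    ... | inj₂ B≤a | _ | _ | _ = new-edge-consecutive va vb ab (inj₁ B≤a) vc (qa<qc , qc<qb)
    ... | _ | inj₂ B≤b | _ | _ = new-edge-consecutive va vb ab (inj₂ B≤b) vc (qa<qc , qc<qb)
    ... | _ | _ | inj₂ B≤c | _ = new-edge-consecutive vc vd cd (inj₁ B≤c) vb (qc<qb , qb<qd)
    ... | _ | _ | _ | inj₂ B≤d = new-edge-consecutive vc vd cd (inj₂ B≤d) vb (qc<qb , qb<qd)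

    extend-isLayout : IsLayout B C extend
    extend-isLayout = record
      { injective      = extend-injective
      ; consecutive-A  = λ vx vy x≢y x+y≡B → extend-consecutive vx vy x≢y (inj₁ x+y≡B)
      ; consecutive-B  = λ vx vy x≢y x+y≡C → extend-consecutive vx vy x≢y (inj₂ (inj₁ x+y≡C))
      ; consecutive-AB = λ vx vy x≢y x+y≡D → extend-consecutive vx vy x≢y (inj₂ (inj₂ x+y≡D))
      ; noncrossing    = extend-noncrossing
      }

layout : ℕ → ℕ → ℕ
layout zero = λ _ → 0
layout (suc j) = Extension.extend (fib (2 + j)) (fib (3 + j)) (layout j)

vertex-of-2 : ∀ {x} → Vertex 2 x → x ≡ 1
vertex-of-2 (s≤s z≤n , s≤s (s≤s z≤n)) = refl

layout-isLayout : ∀ j → IsLayout (fib (2 + j)) (fib (3 + j)) (layout j)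
layout-isLayout zero = record
  { injective      = λ vx vy _ → same-vertex vx vy
  ; consecutive-A  = single-vertex
  ; consecutive-B  = single-vertex
  ; consecutive-AB = single-vertex
  ; noncrossing    = λ va vb _ _ (a≢b , _) _ → contradiction (same-vertex va vb) a≢b
  }
  where
  same-vertex : ∀ {x y} → Vertex 2 x → Vertex 2 y → x ≡ y
  same-vertex vx vy = trans (vertex-of-2 vx) (sym (vertex-of-2 vy))
  single-vertex : ∀ {s} → SumConsecutive 2 (layout zero) s
  single-vertex vx vy x≢y _ = contradiction (same-vertex vx vy) x≢y
layout-isLayout (suc j) =
  Extension.extend-isLayout (fib (2 + j)) (fib (3 + j)) (layout j)
    (fib[2+m]<fib[3+m] j) (layout-isLayout j) (fib-gap (3 + j))

theorem14 : (n : ℕ) → n ≥ 1 → Outerplanar (fibSumGraph n)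
theorem14 zero ()
theorem14 (suc m) _ =
  outerplanar-by-layout (fibSumGraph (suc m)) (layout m ∘ label)
    (label-injective ∘ injective (vertex _) (vertex _))
    λ (a≢b , fib-ab) (c≢d , fib-cd) →
      noncrossing (vertex _) (vertex _) (vertex _) (vertex _)
                  (a≢b ∘ label-injective , fib-ab) (c≢d ∘ label-injective , fib-cd)
  where
  open IsLayout (layout-isLayout m)
  label : Fin (suc m) → ℕ
  label x = suc (toℕ x)
  label-injective : Injective _≡_ _≡_ label
  label-injective = Fin.toℕ-injective ∘ suc-injective
  vertex : ∀ x → Vertex (fib (3 + m)) (label x)
  vertex x = s≤s z≤n , ≤-<-trans (Fin.toℕ<n x) (1+m<fib[3+m] m)
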